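{- For any (finite) tree $T$, $\dim(T) \le Z(T)$.
   Context: $\dim(T)$ is the metric dimension: the minimum cardinality of a set $W\subseteq V(T)$ such that every pair of distinct vertices $u,v$ has some $w\in W$ with $d(u,w)\ne d(v,w)$ ($d$ = shortest-path distance). $Z(T)$ is the zero forcing number: the minimum cardinality of an initial set $S$ of black vertices (others white) such that repeated application of the rule "if a black vertex has exactly one white neighbor, that neighbor turns black" eventually turns all vertices black. -}

module Defs where

open import Data.Nat using (ℕ; zero; suc; _≤_; _+_)
open import Data.Bool using (Bool; T)
open import Data.Fin using (Fin; zero; suc; inject₁; fromℕ)
open import Data.Fin.Subset using (Subset; _∈_; ∣_∣)
open import Data.Product using (Σ; ∃; _×_; _,_)
open import Relation.Binary.PropositionalEquality using (_≡_; _≢_)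
open import Relation.Nullary using (¬_)
open import Function.Definitions using (Injective)

record Graph (n : ℕ) : Set where
  field
    adj   : Fin n → Fin n → Bool
    sym   : ∀ u v → adj u v ≡ adj v u
    irrefl : ∀ u → adj u u ≡ Data.Bool.false

open Graph public

E : ∀ {n} → Graph n → Fin n → Fin n → Set
E G u v = T (adj G u v)

data Walk {n} (G : Graph n) : Fin n → Fin n → ℕ → Set where
  here : ∀ {u} → Walk G u u zero
  step : ∀ {u x v k} → E G u x → Walk G x v k → Walk G u v (suc k)

Dist : ∀ {n} → Graph n → Fin n → Fin n → ℕ → Set
Dist G u v k = Walk G u v k × (∀ m → Walk G u v m → k ≤ m)

Connected : ∀ {n} → Graph n → Set
Connected G = ∀ u v → ∃ λ k → Walk G u v k

-- A cycle: k+3 pairwise distinct vertices c₀,…,c_{k+2}, consecutive ones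
-- adjacent and c_{k+2} adjacent to c₀.
record Cycle {n} (G : Graph n) : Set where
  field
    len  : ℕ
    c    : Fin (suc (suc (suc len))) → Fin n
    inj  : Injective _≡_ _≡_ c
    cons : ∀ (i : Fin (suc (suc len))) → E G (c (inject₁ i)) (c (suc i))
    close : E G (c (fromℕ (suc (suc len)))) (c zero)

Acyclic : ∀ {n} → Graph n → Set
Acyclic G = ¬ Cycle G

IsTree : ∀ {n} → Graph n → Set
IsTree {n} G = (1 ≤ n) × Connected G × Acyclic G

Resolves : ∀ {n} → Graph n → Subset n → Set
Resolves {n} G W =
  ∀ (u v : Fin n) → u ≢ v →
    ∃ λ w → w ∈ W × (∀ a b → Dist G u w a → Dist G v w b → a ≢ b)

IsMetricDimension : ∀ {n} → Graph n → ℕ → Set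
IsMetricDimension {n} G k =
  (∃ λ (W : Subset n) → Resolves G W × ∣ W ∣ ≡ k) ×
  (∀ (W : Subset n) → Resolves G W → k ≤ ∣ W ∣)

-- Vertices that are (eventually) black when starting from the black set S
-- and repeatedly applying the forcing rule: a black vertex u all of whose
-- neighbours other than v are black forces its (only white) neighbour v.
data Black {n} (G : Graph n) (S : Subset n) : Fin n → Set where
  initial : ∀ {v} → v ∈ S → Black G S v
  force   : ∀ {u v} → E G u v → Black G S u →
            (∀ w → E G u w → w ≢ v → Black G S w) → Black G S v

ZeroForcing : ∀ {n} → Graph n → Subset n → Set
ZeroForcing G S = ∀ v → Black G S v

IsZeroForcingNumber : ∀ {n} → Graph n → ℕ → Set
IsZeroForcingNumber {n} G k =
  (∃ λ (S : Subset n) → ZeroForcing G S × ∣ S ∣ ≡ k) ×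
  (∀ (S : Subset n) → ZeroForcing G S → k ≤ ∣ S ∣)

module Submission where

-- The proof shows that in a tree every zero forcing set S is resolving; since
-- dim(T) is at most the size of any resolving set, taking S of size Z(T)
-- gives the claim.  Fix distinct u, v and call a vertex equidistant when it
-- has the same distance to u and to v.  If no vertex of S resolves u and v,
-- all of S is equidistant; we show that the forcing rule preserves
-- equidistance, so every vertex, in particular u itself, is equidistant,
-- whence d(v,u) = d(u,u) = 0 and u = v.

open import Defs hiding (sym)
open import Data.Nat using (ℕ; zero; suc; _≤_; z≤n)
open import Data.Nat.Properties
  using (≤-antisym; ≤-trans; n≤1+n; ≤-pred; 1+n≰n; <-cmp; ≮⇒≥; suc-injective; m≢1+n+m)
  renaming (_≟_ to _≟ℕ_)
open import Data.Nat.Induction using (<-rec)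
open import Data.Bool using (T)
open import Data.Fin using (Fin; toℕ; inject₁; fromℕ; fromℕ<)
import Data.Fin as Fin
open import Data.Fin.Properties using (any?; toℕ<n; toℕ-fromℕ<)
  renaming (_≟_ to _≟Fin_)
import Data.Fin.Subset as Subset
open import Data.Fin.Subset.Properties using (_∈?_)
open import Data.List using (List; []; _∷_; _∷ʳ_; length; lookup)
open import Data.List.Membership.Propositional using (_∈_)
open import Data.List.Membership.Propositional.Properties using (∈-lookup)
open import Data.List.Relation.Unary.All using (All; []; _∷_)
import Data.List.Relation.Unary.All as All
open import Data.List.Relation.Unary.All.Properties using (∷ʳ⁺)
open import Data.List.Relation.Unary.Any using (here; there)
open import Data.List.Relation.Unary.AllPairs using ([]; _∷_)
open import Data.List.Relation.Unary.Unique.Propositional using (Unique)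
import Data.List.Relation.Unary.Unique.Propositional.Properties as Unique
open import Data.Product using (∃; _×_; _,_; proj₁; proj₂)
open import Data.Sum using (_⊎_; inj₁; inj₂)
open import Data.Empty using (⊥; ⊥-elim)
open import Relation.Binary.PropositionalEquality
  using (_≡_; _≢_; refl; sym; trans; cong; subst; ≢-sym)
open import Relation.Binary using (tri<; tri≈; tri>)
open import Relation.Nullary using (¬_; Dec; yes; no)
open import Relation.Nullary.Decidable using (_×-dec_; T?; ¬?; decidable-stable)

lookup-injective : ∀ {A : Set} {xs : List A} → Unique xs →
                   ∀ i j → lookup xs i ≡ lookup xs j → i ≡ j
lookup-injective (_ ∷ _)       Fin.zero    Fin.zero    _  = refl
lookup-injective (x≢xs ∷ _)    Fin.zero    (Fin.suc j) eq = ⊥-elim (All.lookup x≢xs (∈-lookup j) eq)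
lookup-injective (x≢xs ∷ _)    (Fin.suc i) Fin.zero    eq = ⊥-elim (All.lookup x≢xs (∈-lookup i) (sym eq))
lookup-injective (_ ∷ unique) (Fin.suc i) (Fin.suc j) eq = cong Fin.suc (lookup-injective unique i j eq)

differ-by-one : ∀ {a k} → a ≤ suc k → k ≤ suc a → a ≢ k → a ≡ suc k ⊎ suc a ≡ k
differ-by-one {a} {k} a≤1+k k≤1+a a≢k with <-cmp a k
... | tri< a<k _ _ = inj₂ (≤-antisym a<k k≤1+a)
... | tri≈ _ a≡k _ = ⊥-elim (a≢k a≡k)
... | tri> _ _ k<a = inj₁ (≤-antisym a≤1+k k<a)

module _ {n : ℕ} (G : Graph n) where

  edge-sym : ∀ {u v} → E G u v → E G v u
  edge-sym {u} {v} = subst T (Graph.sym G u v)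

  edge-irrefl : ∀ {u} → ¬ E G u u
  edge-irrefl {u} = subst T (Graph.irrefl G u)

  walk-length-zero : ∀ {u v} → Walk G u v 0 → u ≡ v
  walk-length-zero here = refl

  walk-snoc : ∀ {u x y k} → Walk G u x k → E G x y → Walk G u y (suc k)
  walk-snoc here         e = step e here
  walk-snoc (step e′ w) e = step e′ (walk-snoc w e)

  walk-unsnoc : ∀ {u y k} → Walk G u y (suc k) → ∃ λ p → Walk G u p k × E G p y
  walk-unsnoc (step e here) = _ , here , e
  walk-unsnoc (step e (step e′ w)) with walk-unsnoc (step e′ w)
  ... | p , w′ , e″ = p , step e w′ , e″

  walk? : ∀ k u v → Dec (Walk G u v k)
  walk? zero u v with u ≟Fin v
  ... | yes refl = yes here
  ... | no  u≢v  = no (λ w → u≢v (walk-length-zero w))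
  walk? (suc k) u v with any? (λ x → T? (adj G u x) ×-dec walk? k x v)
  ... | yes (x , e , w) = yes (step e w)
  ... | no  none        = no (λ { (step e w) → none (_ , e , w) })

  -- AtLeast r j c: every walk from r to c has length at least j, so
  -- Dist G r c k is Walk G r c k × AtLeast r k c.
  AtLeast : Fin n → ℕ → Fin n → Set
  AtLeast r j c = ∀ m → Walk G r c m → j ≤ m

  shortest : ∀ {u v} m → Walk G u v m → ∃ (Dist G u v)
  shortest {u} {v} = <-rec (λ m → Walk G u v m → ∃ (Dist G u v)) search
    where
    search : ∀ m → (∀ {i} → suc i ≤ m → Walk G u v i → ∃ (Dist G u v)) →
             Walk G u v m → ∃ (Dist G u v)
    search m shorter w with any? (λ (i : Fin m) → walk? (toℕ i) u v)
    ... | yes (i , w′) = shorter (toℕ<n i) w′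
    ... | no  none     = m , w , minimal
      where
      minimal : AtLeast u m v
      minimal m′ w′ = ≮⇒≥ λ m′<m →
        none (fromℕ< m′<m , subst (Walk G u v) (sym (toℕ-fromℕ< m′<m)) w′)

  dist-unique : ∀ {u v a b} → Dist G u v a → Dist G u v b → a ≡ b
  dist-unique (wa , a-min) (wb , b-min) = ≤-antisym (a-min _ wb) (b-min _ wa)

  parent-level : ∀ {r a p j} → AtLeast r (suc j) a → E G p a → AtLeast r j p
  parent-level far e m w = ≤-pred (far (suc m) (walk-snoc w e))

  weaken-level : ∀ {r c j} → AtLeast r (suc j) c → AtLeast r j c
  weaken-level far m w = ≤-trans (n≤1+n _) (far m w)

  closer-distinct : ∀ {r p c j} → Walk G r p j → AtLeast r (suc j) c → p ≢ c
  closer-distinct w far refl = 1+n≰n (far _ w)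

  parent : ∀ {r x k} → Dist G r x (suc k) → ∃ λ p → E G p x × Dist G r p k
  parent (w , far) with walk-unsnoc w
  ... | p , wp , e = p , e , wp , parent-level far e

  data Path : Fin n → Fin n → List (Fin n) → Set where
    [_] : ∀ a → Path a a (a ∷ [])
    _∷_ : ∀ {a c b L} → E G a c → Path c b L → Path a b (a ∷ L)

  path-snoc : ∀ {a b b′ L} → Path a b L → E G b b′ → Path a b′ (L ∷ʳ b′)
  path-snoc [ _ ]     e = e ∷ [ _ ]
  path-snoc (e′ ∷ p) e = e′ ∷ path-snoc p e

  path-first : ∀ {a b L} → Path a b L → a ∈ L
  path-first [ _ ]   = here refl
  path-first (_ ∷ _) = here refl

  path-last : ∀ {a b L} → Path a b L → b ∈ L
  path-last [ _ ]   = here refl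
  path-last (_ ∷ p) = there (path-last p)

  path-edge : ∀ {a b x xs} → Path a b (x ∷ xs) → ∀ (i : Fin (length xs)) →
              E G (lookup (x ∷ xs) (inject₁ i)) (lookup (x ∷ xs) (Fin.suc i))
  path-edge (e ∷ [ _ ])    Fin.zero    = e
  path-edge (e ∷ (_ ∷ _))  Fin.zero    = e
  path-edge (_ ∷ (e′ ∷ p)) (Fin.suc i) = path-edge (e′ ∷ p) i

  path-end : ∀ {a b x xs} → Path a b (x ∷ xs) → lookup (x ∷ xs) (fromℕ (length xs)) ≡ b
  path-end [ _ ]          = refl
  path-end (_ ∷ [ _ ])    = refl
  path-end (_ ∷ (e′ ∷ p)) = path-end (e′ ∷ p)

  path-cycle : ∀ {a b x y rest} → Path a b (a ∷ x ∷ y ∷ rest) → E G b a →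
               Unique (a ∷ x ∷ y ∷ rest) → Cycle G
  path-cycle {a} {b} {x} {y} {rest} p closing unique = record
    { len   = length rest
    ; c     = lookup (a ∷ x ∷ y ∷ rest)
    ; inj   = lookup-injective unique _ _
    ; cons  = path-edge p
    ; close = subst (λ z → E G z a) (sym (path-end p)) closing
    }

  -- Let a ≠ b both be reachable from r in j steps and be
  -- joined by a duplicate-free path all of whose vertices are at distance
  -- ≥ j from r.  Prepending the parent of a and appending the parent of b
  -- keeps the path duplicate-free (the parents lie one level lower) and
  -- lowers the level by one; when the parents coincide, the path closes up
  -- into a cycle.  Level 0 is impossible since then a = r = b.
  level-cycle : ∀ {r} j {a b L} → Walk G r a j → Walk G r b j → a ≢ b →
                Path a b L → Unique L → All (AtLeast r j) L → Cycle G
  level-cycle zero wa wb a≢b _ _ _ =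
    ⊥-elim (a≢b (trans (sym (walk-length-zero wa)) (walk-length-zero wb)))
  level-cycle (suc j) wa wb a≢b path unique far
    with walk-unsnoc wa | walk-unsnoc wb
  ... | pa , wpa , ea | pb , wpb , eb with pa ≟Fin pb
  level-cycle (suc j) wa wb a≢b [ _ ] unique far
      | _ | _ | yes refl = ⊥-elim (a≢b refl)
  level-cycle (suc j) {L = _ ∷ _ ∷ _} wa wb a≢b (e ∷ path) unique far
      | pa , wpa , ea | pb , wpb , eb | yes refl =
    path-cycle (ea ∷ (e ∷ path)) (edge-sym eb)
      (All.map (closer-distinct wpa) far ∷ unique)
  ... | no pa≢pb =
    level-cycle j wpa wpb pa≢pb
      (ea ∷ path-snoc path (edge-sym eb))
      (∷ʳ⁺ (All.map (closer-distinct wpa) far) pa≢pb ∷ Unique.++⁺ unique ([] ∷ []) pb∉L)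
      (parent-level (All.lookup far (path-first path)) ea
        ∷ ∷ʳ⁺ (All.map weaken-level far) (parent-level (All.lookup far (path-last path)) eb))
    where
    pb∉L : ∀ {z} → ¬ (z ∈ _ × z ∈ pb ∷ [])
    pb∉L (z∈L , here refl) = closer-distinct wpb (All.lookup far z∈L) refl

  module Acyclic-Levels (acyclic : Acyclic G) where

    level-no-edge : ∀ {r x y k} → Dist G r x k → Dist G r y k → ¬ E G x y
    level-no-edge (wx , x-far) (wy , y-far) e =
      acyclic (level-cycle _ wx wy x≢y (e ∷ [ _ ])
        ((x≢y ∷ []) ∷ ([] ∷ [])) (x-far ∷ y-far ∷ []))
      where
      x≢y : _ ≢ _
      x≢y refl = edge-irrefl e

    neighbour-dist : ∀ {r x y k a} → Dist G r x k → Dist G r y a → E G x y →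
                     a ≡ suc k ⊎ suc a ≡ k
    neighbour-dist dx@(wx , x-far) dy@(wy , y-far) e =
      differ-by-one (y-far _ (walk-snoc wx e)) (x-far _ (walk-snoc wy (edge-sym e)))
        (λ { refl → level-no-edge dx dy e })

    unique-parent : ∀ {r x y p k} → Dist G r x (suc k) → Dist G r y k → Dist G r p k →
                    E G y x → E G p x → y ≡ p
    unique-parent {y = y} {p} (_ , x-far) (wy , y-far) (wp , p-far) ey ep with y ≟Fin p
    ... | yes y≡p = y≡p
    ... | no  y≢p = ⊥-elim (acyclic (level-cycle _ wy wp y≢p (ey ∷ (edge-sym ep ∷ [ _ ]))
            ((closer-distinct wy x-far ∷ y≢p ∷ []) ∷ (≢-sym (closer-distinct wp x-far) ∷ []) ∷ ([] ∷ []))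
            (y-far ∷ weaken-level x-far ∷ p-far ∷ [])))

  black-induction : ∀ {S} (P : Fin n → Set) → (∀ v → v Subset.∈ S → P v) →
    (∀ {x y} → E G x y → P x → (∀ w → E G x w → w ≢ y → P w) → P y) →
    ∀ {v} → Black G S v → P v
  black-induction P initial-P forcing-P (initial v∈S) = initial-P _ v∈S
  black-induction P initial-P forcing-P (force e black-u others) =
    forcing-P e (black-induction P initial-P forcing-P black-u)
      (λ w e′ w≢v → black-induction P initial-P forcing-P (others w e′ w≢v))

  module Tree (connected : Connected G) (acyclic : Acyclic G) where
    open Acyclic-Levels acyclic

    distance : Fin n → Fin n → ℕ
    distance u v = proj₁ (shortest _ (proj₂ (connected u v)))

    distance-spec : ∀ u v → Dist G u v (distance u v)
    distance-spec u v = proj₂ (shortest _ (proj₂ (connected u v)))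

    -- Seen from r, let y be a neighbour of x one level below x, and seen
    -- from s one level above x.  The parent p of x towards s is then a
    -- neighbour of x other than y; if it is equidistant from r and s, it is
    -- a second parent of x towards r, contradicting unique-parent.
    mixed-step : ∀ {r s x y k} → E G x y →
      Dist G r y k → Dist G r x (suc k) → Dist G s x (suc k) → Dist G s y (suc (suc k)) →
      (∀ w → E G x w → w ≢ y → distance r w ≡ distance s w) → ⊥
    mixed-step {r} {s} {y = y} {k} e ry rx sx sy others with parent sx
    ... | p , ep , sp = y≢p (unique-parent rx ry rp (edge-sym e) ep)
      where
      y≢p : y ≢ p
      y≢p refl = m≢1+n+m k {1} (dist-unique sp sy)
      rp : Dist G r p k
      rp = subst (Dist G r p)
        (trans (others p (edge-sym ep) (≢-sym y≢p)) (dist-unique (distance-spec s p) sp))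
        (distance-spec r p)

    no-mixed-step : ∀ {r s x y} → E G x y → distance r x ≡ distance s x →
      suc (distance r y) ≡ distance r x → distance s y ≡ suc (distance s x) →
      (∀ w → E G x w → w ≢ y → distance r w ≡ distance s w) → ⊥
    no-mixed-step {r} {s} {x} {y} e rx≡sx y-below-r y-above-s =
      mixed-step e (distance-spec r y) rx sx sy
      where
      sx≡1+ry : distance s x ≡ suc (distance r y)
      sx≡1+ry = trans (sym rx≡sx) (sym y-below-r)
      rx : Dist G r x (suc (distance r y))
      rx = subst (Dist G r x) (sym y-below-r) (distance-spec r x)
      sx : Dist G s x (suc (distance r y))
      sx = subst (Dist G s x) sx≡1+ry (distance-spec s x)
      sy : Dist G s y (suc (suc (distance r y)))
      sy = subst (Dist G s y) (trans y-above-s (cong suc sx≡1+ry)) (distance-spec s y)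

    module _ (u v : Fin n) where

      Equidistant : Fin n → Set
      Equidistant y = distance u y ≡ distance v y

      -- By
      -- neighbour-dist, y is one level above or below x as seen from u and
      -- from v; equal directions give equal distances and mixed directions
      -- are excluded by no-mixed-step.
      forcing-preserves-equidistance : ∀ {x y} → E G x y → Equidistant x →
        (∀ w → E G x w → w ≢ y → Equidistant w) → Equidistant y
      forcing-preserves-equidistance {x} {y} e ux≡vx others
        with neighbour-dist (distance-spec u x) (distance-spec u y) e
           | neighbour-dist (distance-spec v x) (distance-spec v y) e
      ... | inj₁ uy≡1+ux | inj₁ vy≡1+vx = trans uy≡1+ux (trans (cong suc ux≡vx) (sym vy≡1+vx))
      ... | inj₂ 1+uy≡ux | inj₂ 1+vy≡vx = suc-injective (trans 1+uy≡ux (trans ux≡vx (sym 1+vy≡vx)))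
      ... | inj₂ y-below-u | inj₁ y-above-v = ⊥-elim (no-mixed-step e ux≡vx y-below-u y-above-v others)
      ... | inj₁ y-above-u | inj₂ y-below-v = ⊥-elim (no-mixed-step e (sym ux≡vx) y-below-v y-above-u
              (λ w e′ w≢y → sym (others w e′ w≢y)))

    -- If no vertex of S
    -- resolves u and v, then S is equidistant, hence so is every forced
    -- vertex, in particular u: d(v,u) = d(u,u) = 0 and u = v.
    zero-forcing-resolves : ∀ S → ZeroForcing G S → Resolves G S
    zero-forcing-resolves S forcing u v u≢v
      with any? (λ w → (w ∈? S) ×-dec ¬? (distance u w ≟ℕ distance v w))
    ... | yes (w , w∈S , uw≢vw) = w , w∈S , λ a b du dv a≡b →
      uw≢vw (trans (dist-unique (distance-spec u w) du) (trans a≡b (dist-unique dv (distance-spec v w))))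
    ... | no none = ⊥-elim (u≢v (sym (walk-length-zero (proj₁ dvu))))
      where
      S-equidistant : ∀ w → w Subset.∈ S → Equidistant u v w
      S-equidistant w w∈S =
        decidable-stable (distance u w ≟ℕ distance v w) (λ uw≢vw → none (w , w∈S , uw≢vw))
      u-equidistant : Equidistant u v u
      u-equidistant = black-induction (Equidistant u v) S-equidistant
        (forcing-preserves-equidistance u v) (forcing u)
      dvu : Dist G v u 0
      dvu = subst (Dist G v u)
        (trans (sym u-equidistant) (dist-unique (distance-spec u u) (here , λ _ _ → z≤n)))
        (distance-spec v u)

theorem2p8 : ∀ {n} (T : Graph n) → IsTree T →
    ∀ (d z : ℕ) → IsMetricDimension T d → IsZeroForcingNumber T z → d ≤ z
theorem2p8 T (_ , connected , acyclic) d z (_ , d-minimal) ((S , forcing , |S|≡z) , _) =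
  subst (d ≤_) |S|≡z (d-minimal S (Tree.zero-forcing-resolves T connected acyclic S forcing))
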